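{- Let $n\geq 5$, $k$ a positive integer, and $D$ a set of vertices of $K(n,2)$. Then $D$ is a $k$-tuple dominating set of $K(n,2)$ if and only if for every pair of distinct elements $a,b\in[n]$, $$i_a+i_b\leq\begin{cases}|D|-k+2, & \text{if } \{a,b\}\in D,\\ |D|-k, & \text{if } \{a,b\}\notin D.\end{cases}$$
   Context: The Kneser graph $K(n,2)$ has as vertices the $2$-subsets of $[n]=\{1,\dots,n\}$, two vertices adjacent iff disjoint. For a vertex $v$, $N[v]$ is its closed neighbourhood. A set $D$ of vertices is a $k$-tuple dominating set if $|N[v]\cap D|\geq k$ for every vertex $v$. For $x\in[n]$, $i_x=i_x(D)$ denotes the number of vertices of $D$ containing $x$. -}

module Defs where

open import Data.Nat using (ℕ; _+_; _∸_; _≤_)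
open import Data.Fin using (Fin; _<_; _≟_; _<?_)
open import Data.Fin.Properties using ()
open import Data.Bool using (Bool; true; false; _∧_; _∨_; not; T)
open import Data.List using (List; []; _∷_; filter; length; concatMap)
open import Data.List using (allFin)
open import Data.Product using (Σ; _×_; _,_; proj₁; proj₂)
open import Relation.Nullary using (¬_; Dec; yes; no)
open import Relation.Nullary.Decidable using (⌊_⌋)
open import Relation.Unary using (Decidable)
open import Data.Bool.Properties using (T?)

-- A vertex of K(n,2): a 2-subset {i,j} of [n] = Fin n, represented uniquely
-- as an ordered pair (i , j) with i < j.
Vertex : ℕ → Set
Vertex n = Σ (Fin n × Fin n) (λ p → proj₁ p < proj₂ p)

vertices : (n : ℕ) → List (Vertex n)
vertices n = concatMap (λ i → concatMap (λ j → pairIf i j) (allFin n)) (allFin n)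
  where
  pairIf : Fin n → Fin n → List (Vertex n)
  pairIf i j with i <? j
  ... | yes i<j = ((i , j) , i<j) ∷ []
  ... | no  _   = []

_∈ᵥ_ : {n : ℕ} → Fin n → Vertex n → Bool
x ∈ᵥ ((i , j) , _) = ⌊ x ≟ i ⌋ ∨ ⌊ x ≟ j ⌋

_==ᵥ_ : {n : ℕ} → Vertex n → Vertex n → Bool
((i , j) , _) ==ᵥ ((k , l) , _) = ⌊ i ≟ k ⌋ ∧ ⌊ j ≟ l ⌋

-- Adjacency in K(n,2): the two 2-subsets are disjoint.
disjoint : {n : ℕ} → Vertex n → Vertex n → Bool
disjoint ((i , j) , _) w = not (i ∈ᵥ w) ∧ not (j ∈ᵥ w)

inClosedNbhd : {n : ℕ} → Vertex n → Vertex n → Bool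
inClosedNbhd v w = (w ==ᵥ v) ∨ disjoint v w

VSet : ℕ → Set
VSet n = Vertex n → Bool

countD : {n : ℕ} → VSet n → (Vertex n → Bool) → ℕ
countD {n} D P = length (filter (λ w → T? (D w ∧ P w)) (vertices n))

card : {n : ℕ} → VSet n → ℕ
card D = countD D (λ _ → true)

nbhdCount : {n : ℕ} → VSet n → Vertex n → ℕ
nbhdCount D v = countD D (inClosedNbhd v)

iₓ : {n : ℕ} → VSet n → Fin n → ℕ
iₓ D x = countD D (x ∈ᵥ_)

IsKTupleDominating : (n k : ℕ) → VSet n → Set
IsKTupleDominating n k D = (v : Vertex n) → k ≤ nbhdCount D v

-- The bound in the statement, for a vertex {a,b} (a < b): |D| - k + 2 if {a,b} ∈ D,
-- |D| - k otherwise.  (Stated additively to avoid truncated subtraction: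
-- i_a + i_b ≤ |D| - k + c  is written  i_a + i_b + k ≤ |D| + c.)
PairCondition : (n k : ℕ) → VSet n → Set
PairCondition n k D = (v : Vertex n) →
  let a = proj₁ (proj₁ v) ; b = proj₂ (proj₁ v) in
  iₓ D a + iₓ D b + k ≤ card D + (if D v then 2 else 0)
  where open import Data.Bool using (if_then_else_)

-- Double counting: for v = {a,b} and any w ∈ D, the number of the three
-- conditions "w ∈ N[v]", "a ∈ w", "b ∈ w" that w satisfies is 1, or 3 when w = v.
-- Summing over D gives i_a + i_b + |N[v] ∩ D| = |D| + 2[v ∈ D], and the
-- equivalence is this identity rearranged.
module Submission where

open import Defs
open import Data.Nat as ℕ using (ℕ; _+_; _*_; _≤_; _<_)
open import Data.Bool using (Bool; true; false; _∧_; if_then_else_)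
open import Data.Bool.Properties using (T?; ∧-zeroʳ)
open import Data.Fin using (Fin; zero; suc; _<?_)
open import Data.Fin.Properties using (_≟_; <-irrefl; <-asym; <-irrelevant)
open import Data.List using (List; []; _∷_; map; filter; length; concatMap; allFin; tabulate; _++_)
open import Data.List.Properties using (map-cong; map-++; map-tabulate; tabulate-cong)
open import Data.Nat.ListAction using (sum)
open import Data.Nat.ListAction.Properties using (sum-++)
open import Data.Nat.Properties
  using (+-assoc; +-identityʳ; *-identityʳ; +-monoʳ-≤; +-cancelˡ-≤; +-commutativeSemigroup)
open import Algebra.Properties.CommutativeSemigroup +-commutativeSemigroup
  using () renaming (interchange to +-interchange)
open import Data.Product using (_,_; proj₁; proj₂)
open import Data.Empty using (⊥-elim)
open import Function.Base using (_∘_)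
open import Function.Bundles using (_⇔_; mk⇔)
open import Relation.Nullary using (yes; no)
open import Relation.Nullary.Decidable using (⌊_⌋)
open import Relation.Binary.PropositionalEquality

𝟙 : Bool → ℕ
𝟙 b = if b then 1 else 0

module _ {A : Set} where

  sumBy : (A → ℕ) → List A → ℕ
  sumBy f xs = sum (map f xs)

  sumBy-cong : {f g : A → ℕ} → (∀ x → f x ≡ g x) → (xs : List A) → sumBy f xs ≡ sumBy g xs
  sumBy-cong f≗g xs = cong sum (map-cong f≗g xs)

  sumBy-zero : (xs : List A) → sumBy (λ _ → 0) xs ≡ 0
  sumBy-zero []       = refl
  sumBy-zero (_ ∷ xs) = sumBy-zero xs

  sumBy-+ : (f g : A → ℕ) (xs : List A) → sumBy (λ x → f x + g x) xs ≡ sumBy f xs + sumBy g xs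
  sumBy-+ f g []       = refl
  sumBy-+ f g (x ∷ xs) = begin
    f x + g x + sumBy (λ x → f x + g x) xs   ≡⟨ cong (f x + g x +_) (sumBy-+ f g xs) ⟩
    f x + g x + (sumBy f xs + sumBy g xs)    ≡⟨ +-interchange (f x) (g x) (sumBy f xs) (sumBy g xs) ⟩
    f x + sumBy f xs + (g x + sumBy g xs)    ∎
    where
    open ≡-Reasoning

  sumBy-+₃ : (f g h : A → ℕ) (xs : List A) →
             sumBy (λ x → f x + g x + h x) xs ≡ sumBy f xs + sumBy g xs + sumBy h xs
  sumBy-+₃ f g h xs =
    trans (sumBy-+ (λ x → f x + g x) h xs) (cong (_+ sumBy h xs) (sumBy-+ f g xs))

  length-filter-T? : (P : A → Bool) (xs : List A) →
                     length (filter (λ x → T? (P x)) xs) ≡ sumBy (λ x → 𝟙 (P x)) xs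
  length-filter-T? P []       = refl
  length-filter-T? P (x ∷ xs) with P x
  ... | true  = cong ℕ.suc (length-filter-T? P xs)
  ... | false = length-filter-T? P xs

  sumBy-𝟙-∧ : (b : Bool) (P : A → Bool) (xs : List A) →
              sumBy (λ x → 𝟙 (b ∧ P x)) xs ≡ 𝟙 b * sumBy (λ x → 𝟙 (P x)) xs
  sumBy-𝟙-∧ true  P xs = sym (+-identityʳ _)
  sumBy-𝟙-∧ false P xs = sumBy-zero xs

sumBy-concatMap : {A B : Set} (f : B → ℕ) (g : A → List B) (xs : List A) →
                  sumBy f (concatMap g xs) ≡ sumBy (λ x → sumBy f (g x)) xs
sumBy-concatMap f g []       = refl
sumBy-concatMap f g (x ∷ xs) = begin
  sum (map f (g x ++ concatMap g xs))         ≡⟨ cong sum (map-++ f (g x) (concatMap g xs)) ⟩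
  sum (map f (g x) ++ map f (concatMap g xs)) ≡⟨ sum-++ (map f (g x)) _ ⟩
  sumBy f (g x) + sumBy f (concatMap g xs)    ≡⟨ cong (sumBy f (g x) +_) (sumBy-concatMap f g xs) ⟩
  sumBy f (g x) + sumBy (λ x → sumBy f (g x)) xs ∎
  where open ≡-Reasoning

sum-tabulate-zero : (n : ℕ) → sum (tabulate {n = n} (λ _ → 0)) ≡ 0
sum-tabulate-zero ℕ.zero    = refl
sum-tabulate-zero (ℕ.suc n) = sum-tabulate-zero n

-- Not definitional: ⌊_⌋ matches on the whole Dec record, proof included.
⌊suc≟suc⌋ : {n : ℕ} (i j : Fin n) → ⌊ suc i ≟ suc j ⌋ ≡ ⌊ i ≟ j ⌋
⌊suc≟suc⌋ i j with i ≟ j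
... | yes _ = refl
... | no  _ = refl

⌊≟⌋-sym : {n : ℕ} (i j : Fin n) → ⌊ i ≟ j ⌋ ≡ ⌊ j ≟ i ⌋
⌊≟⌋-sym i j with i ≟ j | j ≟ i
... | yes _   | yes _   = refl
... | yes i≡j | no  j≢i = ⊥-elim (j≢i (sym i≡j))
... | no  i≢j | yes j≡i = ⊥-elim (i≢j (sym j≡i))
... | no  _   | no  _   = refl

sumBy-allFin-≟ : {n : ℕ} (b : Fin n) → sumBy (λ j → 𝟙 ⌊ j ≟ b ⌋) (allFin n) ≡ 1
sumBy-allFin-≟ {n} b = trans (cong sum (map-tabulate {n = n} (λ j → j) _)) (sum-tabulate-≟ b)
  where
  sum-tabulate-≟ : {m : ℕ} (c : Fin m) → sum (tabulate (λ j → 𝟙 ⌊ j ≟ c ⌋)) ≡ 1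
  sum-tabulate-≟ {ℕ.suc m} zero    = cong ℕ.suc (sum-tabulate-zero m)
  sum-tabulate-≟ {ℕ.suc m} (suc c) =
    trans (cong sum (tabulate-cong {n = m} (λ j → cong 𝟙 (⌊suc≟suc⌋ j c)))) (sum-tabulate-≟ c)

-- The helper enumerating the vertices {i,j} of Defs.vertices is local to its
-- where block; it is recovered here by unification with the unfolded definition.
mutual
  pairIf : (n : ℕ) → Fin n → Fin n → List (Vertex n)
  pairIf n = _

  vertices-concatMap : (n : ℕ) →
                       vertices n ≡ concatMap (λ i → concatMap (pairIf n i) (allFin n)) (allFin n)
  vertices-concatMap n = refl

module _ {n : ℕ} (v : Vertex n) where
  private
    a = proj₁ (proj₁ v)
    b = proj₂ (proj₁ v)

  sumBy-pairIf-==ᵥ : (i j : Fin n) →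
                     sumBy (λ w → 𝟙 (w ==ᵥ v)) (pairIf n i j) ≡ 𝟙 (⌊ i ≟ a ⌋ ∧ ⌊ j ≟ b ⌋)
  sumBy-pairIf-==ᵥ i j with i <? j
  ... | yes _ = +-identityʳ _
  ... | no i≮j with i ≟ a | j ≟ b
  ...   | yes refl | yes refl = ⊥-elim (i≮j (proj₂ v))
  ...   | yes _    | no  _    = refl
  ...   | no  _    | _        = refl

  sumBy-vertices-==ᵥ : sumBy (λ w → 𝟙 (w ==ᵥ v)) (vertices n) ≡ 1
  sumBy-vertices-==ᵥ = begin
    sumBy 𝟙==v (vertices n)
      ≡⟨ cong (sumBy 𝟙==v) (vertices-concatMap n) ⟩
    sumBy 𝟙==v (concatMap (λ i → concatMap (pairIf n i) (allFin n)) (allFin n))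
      ≡⟨ sumBy-concatMap 𝟙==v _ (allFin n) ⟩
    sumBy (λ i → sumBy 𝟙==v (concatMap (pairIf n i) (allFin n))) (allFin n)
      ≡⟨ sumBy-cong row (allFin n) ⟩
    sumBy (λ i → 𝟙 ⌊ i ≟ a ⌋) (allFin n)
      ≡⟨ sumBy-allFin-≟ a ⟩
    1 ∎
    where
    open ≡-Reasoning
    𝟙==v : Vertex n → ℕ
    𝟙==v w = 𝟙 (w ==ᵥ v)
    row : (i : Fin n) → sumBy 𝟙==v (concatMap (pairIf n i) (allFin n)) ≡ 𝟙 ⌊ i ≟ a ⌋
    row i = begin
      sumBy 𝟙==v (concatMap (pairIf n i) (allFin n))
        ≡⟨ sumBy-concatMap 𝟙==v (pairIf n i) (allFin n) ⟩
      sumBy (λ j → sumBy 𝟙==v (pairIf n i j)) (allFin n)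
        ≡⟨ sumBy-cong (sumBy-pairIf-==ᵥ i) (allFin n) ⟩
      sumBy (λ j → 𝟙 (⌊ i ≟ a ⌋ ∧ ⌊ j ≟ b ⌋)) (allFin n)
        ≡⟨ sumBy-𝟙-∧ ⌊ i ≟ a ⌋ (λ j → ⌊ j ≟ b ⌋) (allFin n) ⟩
      𝟙 ⌊ i ≟ a ⌋ * sumBy (λ j → 𝟙 ⌊ j ≟ b ⌋) (allFin n)
        ≡⟨ cong (𝟙 ⌊ i ≟ a ⌋ *_) (sumBy-allFin-≟ b) ⟩
      𝟙 ⌊ i ≟ a ⌋ * 1
        ≡⟨ *-identityʳ _ ⟩
      𝟙 ⌊ i ≟ a ⌋ ∎

  incidences+closedNbhd : (w : Vertex n) →
    𝟙 (a ∈ᵥ w) + 𝟙 (b ∈ᵥ w) + 𝟙 (inClosedNbhd v w) ≡ 1 + 𝟙 (w ==ᵥ v) + 𝟙 (w ==ᵥ v)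
  incidences+closedNbhd ((i , j) , i<j)
    rewrite ⌊≟⌋-sym i a | ⌊≟⌋-sym j b
    with a ≟ i | a ≟ j | b ≟ i | b ≟ j
  ... | yes refl | yes refl | _        | _        = ⊥-elim (<-irrefl refl i<j)
  ... | _        | _        | yes refl | yes refl = ⊥-elim (<-irrefl refl i<j)
  ... | yes refl | _        | yes refl | _        = ⊥-elim (<-irrefl refl (proj₂ v))
  ... | _        | yes refl | _        | yes refl = ⊥-elim (<-irrefl refl (proj₂ v))
  ... | _        | yes refl | yes refl | _        = ⊥-elim (<-asym (proj₂ v) i<j)
  ... | yes _    | no  _    | no  _    | yes _    = refl
  ... | yes _    | no  _    | no  _    | no  _    = refl
  ... | no  _    | yes _    | no  _    | no  _    = refl
  ... | no  _    | no  _    | yes _    | no  _    = refl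
  ... | no  _    | no  _    | no  _    | yes _    = refl
  ... | no  _    | no  _    | no  _    | no  _    = refl

  module _ (D : VSet n) where

    countD-sumBy : (P : Vertex n → Bool) → countD D P ≡ sumBy (λ w → 𝟙 (D w ∧ P w)) (vertices n)
    countD-sumBy P = length-filter-T? (λ w → D w ∧ P w) (vertices n)

    ∧-==ᵥ : (w : Vertex n) → D w ∧ (w ==ᵥ v) ≡ D v ∧ (w ==ᵥ v)
    ∧-==ᵥ ((i , j) , i<j) with i ≟ a | j ≟ b
    ... | yes refl | yes refl rewrite <-irrelevant i<j (proj₂ v) = refl
    ... | yes _    | no  _    = trans (∧-zeroʳ (D _)) (sym (∧-zeroʳ (D v)))
    ... | no  _    | _        = trans (∧-zeroʳ (D _)) (sym (∧-zeroʳ (D v)))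

    countD-==ᵥ : countD D (_==ᵥ v) ≡ 𝟙 (D v)
    countD-==ᵥ = begin
      countD D (_==ᵥ v)                                 ≡⟨ countD-sumBy (_==ᵥ v) ⟩
      sumBy (λ w → 𝟙 (D w ∧ (w ==ᵥ v))) (vertices n)    ≡⟨ sumBy-cong (cong 𝟙 ∘ ∧-==ᵥ) (vertices n) ⟩
      sumBy (λ w → 𝟙 (D v ∧ (w ==ᵥ v))) (vertices n)    ≡⟨ sumBy-𝟙-∧ (D v) (_==ᵥ v) (vertices n) ⟩
      𝟙 (D v) * sumBy (λ w → 𝟙 (w ==ᵥ v)) (vertices n)  ≡⟨ cong (𝟙 (D v) *_) sumBy-vertices-==ᵥ ⟩
      𝟙 (D v) * 1                                       ≡⟨ *-identityʳ _ ⟩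
      𝟙 (D v)                                           ∎
      where open ≡-Reasoning

    𝟙-∧-incidences+closedNbhd : (w : Vertex n) →
      𝟙 (D w ∧ (a ∈ᵥ w)) + 𝟙 (D w ∧ (b ∈ᵥ w)) + 𝟙 (D w ∧ inClosedNbhd v w)
        ≡ 𝟙 (D w ∧ true) + 𝟙 (D w ∧ (w ==ᵥ v)) + 𝟙 (D w ∧ (w ==ᵥ v))
    𝟙-∧-incidences+closedNbhd w with D w
    ... | true  = incidences+closedNbhd w
    ... | false = refl

    iₓ+iₓ+nbhdCount : iₓ D a + iₓ D b + nbhdCount D v ≡ card D + (if D v then 2 else 0)
    iₓ+iₓ+nbhdCount = begin
      iₓ D a + iₓ D b + nbhdCount D v
        ≡⟨ cong₂ _+_ (cong₂ _+_ (countD-sumBy (a ∈ᵥ_)) (countD-sumBy (b ∈ᵥ_)))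
                     (countD-sumBy (inClosedNbhd v)) ⟩
      Σ (a ∈ᵥ_) + Σ (b ∈ᵥ_) + Σ (inClosedNbhd v)
        ≡⟨ sym (sumBy-+₃ (𝟙∧ (a ∈ᵥ_)) (𝟙∧ (b ∈ᵥ_)) (𝟙∧ (inClosedNbhd v)) (vertices n)) ⟩
      sumBy (λ w → 𝟙∧ (a ∈ᵥ_) w + 𝟙∧ (b ∈ᵥ_) w + 𝟙∧ (inClosedNbhd v) w) (vertices n)
        ≡⟨ sumBy-cong 𝟙-∧-incidences+closedNbhd (vertices n) ⟩
      sumBy (λ w → 𝟙∧ (λ _ → true) w + 𝟙∧ (_==ᵥ v) w + 𝟙∧ (_==ᵥ v) w) (vertices n)
        ≡⟨ sumBy-+₃ (𝟙∧ (λ _ → true)) (𝟙∧ (_==ᵥ v)) (𝟙∧ (_==ᵥ v)) (vertices n) ⟩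
      Σ (λ _ → true) + Σ (_==ᵥ v) + Σ (_==ᵥ v)
        ≡⟨ cong₂ _+_ (cong₂ _+_ (sym (countD-sumBy (λ _ → true))) D==v) D==v ⟩
      card D + 𝟙 (D v) + 𝟙 (D v)
        ≡⟨ +-assoc (card D) (𝟙 (D v)) (𝟙 (D v)) ⟩
      card D + (𝟙 (D v) + 𝟙 (D v))
        ≡⟨ cong (card D +_) (𝟙+𝟙 (D v)) ⟩
      card D + (if D v then 2 else 0) ∎
      where
      open ≡-Reasoning
      𝟙∧ : (Vertex n → Bool) → Vertex n → ℕ
      𝟙∧ P w = 𝟙 (D w ∧ P w)
      Σ : (Vertex n → Bool) → ℕ
      Σ P = sumBy (𝟙∧ P) (vertices n)
      D==v : Σ (_==ᵥ v) ≡ 𝟙 (D v)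
      D==v = trans (sym (countD-sumBy (_==ᵥ v))) countD-==ᵥ
      𝟙+𝟙 : (x : Bool) → 𝟙 x + 𝟙 x ≡ (if x then 2 else 0)
      𝟙+𝟙 true  = refl
      𝟙+𝟙 false = refl

lemma18 : (n k : ℕ) → 5 ≤ n → 0 < k → (D : VSet n) →
          IsKTupleDominating n k D ⇔ PairCondition n k D
lemma18 n k _ _ D = mk⇔ dominating⇒pairCondition pairCondition⇒dominating
  where
  iₐ+iᵦ : Vertex n → ℕ
  iₐ+iᵦ v = iₓ D (proj₁ (proj₁ v)) + iₓ D (proj₂ (proj₁ v))

  dominating⇒pairCondition : IsKTupleDominating n k D → PairCondition n k D
  dominating⇒pairCondition dominating v =
    subst (iₐ+iᵦ v + k ≤_) (iₓ+iₓ+nbhdCount v D) (+-monoʳ-≤ (iₐ+iᵦ v) (dominating v))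

  pairCondition⇒dominating : PairCondition n k D → IsKTupleDominating n k D
  pairCondition⇒dominating pairCondition v =
    +-cancelˡ-≤ (iₐ+iᵦ v) k (nbhdCount D v)
      (subst (iₐ+iᵦ v + k ≤_) (sym (iₓ+iₓ+nbhdCount v D)) (pairCondition v))
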